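{- Let $F$ be a forest, let $e_1,e_2$ be two disjoint edges of $F$, and let $\tau$ be a 2-switch over $F$ that is nontrivial for $F$ and deletes $e_1$ and $e_2$ (i.e., $\tau=\binom{a\ b}{c\ d}$ with $e_1=ab$, $e_2=cd$, interchangeable in $F$). Then: (1) if $e_1$ and $e_2$ lie in the same connected component $T$ of $F$, then $\tau$ is an f-switch over $F$ if and only if $\tau$ is a t-switch over $T$; (2) if $e_1$ and $e_2$ lie in different connected components of $F$, then $\tau$ is an f-switch over $F$.
   Context: Graphs are finite, simple, undirected and labeled. The matrix $\binom{a\ b}{c\ d}$ is interchangeable in a graph $G$ if $ab,cd\in E(G)$, $\{a,b\}\cap\{c,d\}=\varnothing$ and $ac,bd\notin E(G)$; the 2-switch $\tau=\binom{a\ b}{c\ d}$ maps $G$ to $G-ab-cd+ac+bd$ if the matrix is interchangeable in $G$, and to $G$ otherwise; it is nontrivial for $G$ if the matrix is interchangeable in $G$. A nontrivial 2-switch $\tau$ over a tree $T$ is a t-switch if $\tau(T)$ is a tree; a nontrivial 2-switch $\tau$ over a forest $F$ is an f-switch if $\tau(F)$ is a forest. -}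

module Defs where

open import Level using (0ℓ)
open import Data.Nat using (ℕ)
open import Data.Fin using (Fin)
open import Data.List using (List; []; _∷_; _++_)
open import Data.List.Relation.Unary.All using (All)
open import Data.List.Relation.Unary.Linked using (Linked)
open import Data.List.Relation.Unary.Unique.Propositional using (Unique)
open import Data.Product using (Σ; _×_; ∃-syntax)
open import Data.Sum using (_⊎_)
open import Relation.Nullary using (¬_)
open import Relation.Unary using (Pred)
open import Relation.Binary using (Rel)
open import Relation.Binary.PropositionalEquality using (_≡_; _≢_)
open import Function.Bundles using (_⇔_)

record Graph (n : ℕ) : Set₁ where
  field
    V : Pred (Fin n) 0ℓ
    E : Rel (Fin n) 0ℓ
open Graph public

IsSimple : ∀ {n} → Graph n → Set
IsSimple G = (∀ x y → E G x y → E G y x)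
           × (∀ x → ¬ E G x x)
           × (∀ x y → E G x y → V G x × V G y)

data Walk {n} (G : Graph n) : Fin n → Fin n → Set where
  nil  : ∀ {x} → V G x → Walk G x x
  cons : ∀ {x y z} → E G x y → Walk G y z → Walk G x z

Reachable : ∀ {n} → Graph n → Fin n → Fin n → Set
Reachable G x y = Walk G x y

Connected : ∀ {n} → Graph n → Set
Connected G = ∀ x y → V G x → V G y → Walk G x y

IsPath : ∀ {n} → Graph n → List (Fin n) → Set
IsPath G vs = Unique vs × Linked (E G) vs × All (V G) vs

-- A cycle: distinct vertices x, m₁, …, mₖ, y (k ≥ 1, so at least 3 vertices)
-- forming a path, together with the closing edge y x.
HasCycle : ∀ {n} → Graph n → Set
HasCycle {n} G = Σ (Fin n) λ x → Σ (Fin n) λ y → Σ (List (Fin n)) λ ms →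
  (ms ≢ []) × IsPath G (x ∷ ms ++ y ∷ []) × E G y x

Acyclic : ∀ {n} → Graph n → Set
Acyclic G = ¬ HasCycle G

IsForest : ∀ {n} → Graph n → Set
IsForest G = IsSimple G × Acyclic G

IsTree : ∀ {n} → Graph n → Set
IsTree G = IsForest G × Connected G

component : ∀ {n} → Graph n → Fin n → Graph n
component G u = record
  { V = λ x → Reachable G u x
  ; E = λ x y → E G x y × Reachable G u x × Reachable G u y }

record Switch (n : ℕ) : Set where
  constructor sw
  field
    a b c d : Fin n
open Switch public

SameEdge : ∀ {n} → Fin n → Fin n → Fin n → Fin n → Set
SameEdge x y p q = (x ≡ p × y ≡ q) ⊎ (x ≡ q × y ≡ p)

Interchangeable : ∀ {n} → Switch n → Graph n → Set
Interchangeable τ G =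
  E G (a τ) (b τ) × E G (c τ) (d τ)
  × (a τ ≢ c τ) × (a τ ≢ d τ) × (b τ ≢ c τ) × (b τ ≢ d τ)
  × ¬ E G (a τ) (c τ) × ¬ E G (b τ) (d τ)

-- τ(G) = G - ab - cd + ac + bd  (used only when τ is interchangeable in G,
-- i.e. τ nontrivial for G).
switch : ∀ {n} → Switch n → Graph n → Graph n
switch τ G = record
  { V = V G
  ; E = λ x y → (E G x y × ¬ SameEdge x y (a τ) (b τ) × ¬ SameEdge x y (c τ) (d τ))
              ⊎ SameEdge x y (a τ) (c τ) ⊎ SameEdge x y (b τ) (d τ) }

IsTSwitch : ∀ {n} → Switch n → Graph n → Set
IsTSwitch τ T = Interchangeable τ T × IsTree (switch τ T)

IsFSwitch : ∀ {n} → Switch n → Graph n → Set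
IsFSwitch τ F = Interchangeable τ F × IsForest (switch τ F)

-- A graph is acyclic iff each of its edges is a bridge, and adding an edge between two
-- vertices that no walk joins keeps every edge a bridge. Let F′ = F − ab − cd, so that
-- τ(F) = F′ + ac + bd.
-- If no walk joins a and c in F, none joins them in F′, and none joins b and d in F′ + ac;
-- so τ(F) is a forest.
-- Otherwise let T be the component of a. Then τ(T) is a subgraph of τ(F); conversely a walk
-- closing a cycle through an edge of τ(F) cannot stay inside F′ (that would close a cycle
-- of F), so it meets ac or bd and therefore lies in T. For the connectivity of τ(T) it
-- suffices to join a and b in τ(T): cutting a walk from a to c in F at cd and at ab yields a
-- walk in F′ from b to c or from a to d, the other cases being excluded because ab is a
-- bridge of F and ac, bd are bridges of τ(F).

module Submission where

open import Defs
open import Data.Nat using (ℕ)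
open import Data.Fin using (Fin; _≟_)
open import Data.List using (List; []; _∷_; _∷ʳ_; InitLast; initLast; _∷ʳ′_)
open import Data.List.Relation.Unary.All using (All; []; _∷_)
open import Data.List.Relation.Unary.All.Properties using (¬Any⇒All¬; ∷ʳ⁻)
open import Data.List.Relation.Unary.Any using (here; there; any?)
open import Data.List.Relation.Unary.Linked using (Linked; []; [-]; _∷_)
import Data.List.Relation.Unary.Linked as Linked
open import Data.List.Relation.Unary.AllPairs using ([]; _∷_)
open import Data.List.Membership.Propositional using (_∈_)
open import Data.Product using (_×_; _,_; proj₁; proj₂; map₁; map₂; Σ-syntax)
open import Data.Sum using (_⊎_; inj₁; inj₂; assocˡ)
open import Data.Empty using (⊥-elim)
open import Function using (id; _∘_)
open import Relation.Nullary using (¬_; yes; no; Dec)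
open import Relation.Nullary.Decidable using (_×-dec_; _⊎-dec_)
open import Relation.Unary using (Decidable; _⊆_)
open import Relation.Binary using (_⇒_) renaming (Decidable to Decidable₂)
open import Relation.Binary.PropositionalEquality using (_≡_; refl; sym; trans; _≢_; ≢-sym)
open import Function.Bundles using (_⇔_; mk⇔)

module _ {n : ℕ} where
  private variable
    x y z u v p q : Fin n
    G G′ : Graph n
    τ : Switch n

  Undirected : Graph n → Set
  Undirected G = ∀ x y → E G x y → E G y x

  Loopless : Graph n → Set
  Loopless G = ∀ x → ¬ E G x x

  EdgesInV : Graph n → Set
  EdgesInV G = ∀ x y → E G x y → V G x × V G y

  deleteEdge : Graph n → Fin n → Fin n → Graph n
  deleteEdge G u v = record { V = V G ; E = λ x y → E G x y × ¬ SameEdge x y u v }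

  addEdge : Graph n → Fin n → Fin n → Graph n
  addEdge G p q = record { V = V G ; E = λ x y → E G x y ⊎ SameEdge x y p q }

  AllBridges : Graph n → Set
  AllBridges G = ∀ u v → E G u v → ¬ Walk (deleteEdge G u v) v u

  SameEdge-swap : SameEdge x y p q → SameEdge y x p q
  SameEdge-swap (inj₁ (x≡p , y≡q)) = inj₂ (y≡q , x≡p)
  SameEdge-swap (inj₂ (x≡q , y≡p)) = inj₁ (y≡p , x≡q)

  SameEdge-euclidean : SameEdge x y p q → SameEdge u v p q → SameEdge x y u v
  SameEdge-euclidean (inj₁ (refl , refl)) (inj₁ (refl , refl)) = inj₁ (refl , refl)
  SameEdge-euclidean (inj₁ (refl , refl)) (inj₂ (refl , refl)) = inj₂ (refl , refl)
  SameEdge-euclidean (inj₂ (refl , refl)) (inj₁ (refl , refl)) = inj₂ (refl , refl)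
  SameEdge-euclidean (inj₂ (refl , refl)) (inj₂ (refl , refl)) = inj₁ (refl , refl)

  SameEdge-loop : SameEdge x x p q → p ≡ q
  SameEdge-loop (inj₁ (refl , refl)) = refl
  SameEdge-loop (inj₂ (refl , refl)) = refl

  SameEdge-ends : {P : Fin n → Set} → P p → P q → SameEdge x y p q → P x × P y
  SameEdge-ends Pp Pq (inj₁ (refl , refl)) = Pp , Pq
  SameEdge-ends Pp Pq (inj₂ (refl , refl)) = Pq , Pp

  SameEdge? : (x y p q : Fin n) → Dec (SameEdge x y p q)
  SameEdge? x y p q = (x ≟ p ×-dec y ≟ q) ⊎-dec (x ≟ q ×-dec y ≟ p)

  SameEdge-sym : SameEdge x y p q → SameEdge p q x y
  SameEdge-sym (inj₁ (refl , refl)) = inj₁ (refl , refl)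
  SameEdge-sym (inj₂ (refl , refl)) = inj₂ (refl , refl)

  nonEdge-≉ : Undirected G → E G x y → ¬ E G p q → ¬ SameEdge x y p q
  nonEdge-≉ undirected xy pq∉G (inj₁ (refl , refl)) = pq∉G xy
  nonEdge-≉ undirected xy pq∉G (inj₂ (refl , refl)) = pq∉G (undirected _ _ xy)

  ¬SameEdge : x ≢ p → x ≢ q → ¬ SameEdge x y p q
  ¬SameEdge x≢p _ (inj₁ (x≡p , _)) = x≢p x≡p
  ¬SameEdge _ x≢q (inj₂ (x≡q , _)) = x≢q x≡q

  infixr 5 _++ʷ_
  _++ʷ_ : Walk G x y → Walk G y z → Walk G x z
  nil _ ++ʷ w′ = w′
  cons e w ++ʷ w′ = cons e (w ++ʷ w′)

  end∈V : Walk G x y → V G y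
  end∈V (nil y∈V) = y∈V
  end∈V (cons _ w) = end∈V w

  reverseʷ : Undirected G → EdgesInV G → Walk G x y → Walk G y x
  reverseʷ undirected inV (nil x∈V) = nil x∈V
  reverseʷ undirected inV (cons {x} {y} e w) =
    reverseʷ undirected inV w ++ʷ cons (undirected x y e) (nil (proj₁ (inV x y e)))

  mapʷ : V G ⊆ V G′ → E G ⇒ E G′ → Walk G x y → Walk G′ x y
  mapʷ V⊆ E⇒ (nil x∈V) = nil (V⊆ x∈V)
  mapʷ V⊆ E⇒ (cons e w) = cons (E⇒ e) (mapʷ V⊆ E⇒ w)

  mapʷ-from : (P : Fin n → Set) → P ⊆ V G′ → (∀ {x y} → P x → E G x y → P y × E G′ x y) →
              P x → Walk G x y → Walk G′ x y
  mapʷ-from P P⊆V step Px (nil _) = nil (P⊆V Px)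
  mapʷ-from P P⊆V step Px (cons e w) =
    cons (proj₂ (step Px e)) (mapʷ-from P P⊆V step (proj₁ (step Px e)) w)

  invariant-along : (P : Fin n → Set) → (∀ {x y} → P x → E G x y → P y) → P x → Walk G x y → P y
  invariant-along P step Px (nil _) = Px
  invariant-along P step Px (cons e w) = invariant-along P step (step Px e) w

  deleteEdge⊆ : Walk (deleteEdge G u v) x y → Walk G x y
  deleteEdge⊆ = mapʷ id proj₁

  AllBridges-anti : V G′ ⊆ V G → E G′ ⇒ E G → AllBridges G → AllBridges G′
  AllBridges-anti V⊆ E⇒ bridges u v e w = bridges u v (E⇒ e) (mapʷ V⊆ (map₁ E⇒) w)

  lastOf : Fin n → List (Fin n) → Fin n
  lastOf x [] = x
  lastOf _ (y ∷ ys) = lastOf y ys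

  lastOf-∷ʳ : ∀ x ys y → lastOf x (ys ∷ʳ y) ≡ y
  lastOf-∷ʳ x [] y = refl
  lastOf-∷ʳ x (z ∷ zs) y = lastOf-∷ʳ z zs y

  path-suffix : ∀ h L → x ∈ h ∷ L → IsPath G (h ∷ L) →
                Σ[ L′ ∈ List (Fin n) ] IsPath G (x ∷ L′) × lastOf x L′ ≡ lastOf h L
  path-suffix h L (here refl) path = L , path , refl
  path-suffix h (h′ ∷ L) (there x∈) (_ ∷ unique , _ ∷ linked , _ ∷ inV) =
    path-suffix h′ L x∈ (unique , linked , inV)

  walk⇒path : EdgesInV G → Walk G x y → Σ[ L ∈ List (Fin n) ] IsPath G (x ∷ L) × lastOf x L ≡ y
  walk⇒path inV (nil x∈V) = [] , ([] ∷ [] , [-] , x∈V ∷ []) , refl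
  walk⇒path inV (cons {x} {y} e w) with walk⇒path inV w
  ... | L , path@(unique , linked , L∈V) , last≡ with any? (x ≟_) (y ∷ L)
  ...   | yes x∈ = let L′ , path′ , last≡′ = path-suffix y L x∈ path in L′ , path′ , trans last≡′ last≡
  ...   | no x∉ = y ∷ L , (¬Any⇒All¬ _ x∉ ∷ unique , e ∷ linked , proj₁ (inV x y e) ∷ L∈V) , last≡

  closing-cycle : IsSimple G → E G u v → ∀ {L} → InitLast L →
                  IsPath (deleteEdge G u v) (v ∷ L) → lastOf v L ≡ u → HasCycle G
  closing-cycle (_ , loopless , _) uv [] _ refl = ⊥-elim (loopless _ uv)
  closing-cycle _ _ ([] ∷ʳ′ _) (_ , (_ , vu≉uv) ∷ _ , _) refl = ⊥-elim (vu≉uv (inj₂ (refl , refl)))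
  closing-cycle _ uv ((m ∷ ms) ∷ʳ′ y) (unique , linked , inV) last≡u
    with trans (sym (lastOf-∷ʳ m ms y)) last≡u
  ... | refl = _ , y , m ∷ ms , (λ ()) , (unique , Linked.map proj₁ linked , inV) , uv

  acyclic⇒allBridges : IsSimple G → Acyclic G → AllBridges G
  acyclic⇒allBridges simple@(_ , _ , inV) acyclic u v uv w =
    let L , path , last≡ = walk⇒path (λ x y e → inV x y (proj₁ e)) w
    in acyclic (closing-cycle simple uv (initLast L) path last≡)

  linked-avoiding : ∀ {L} → All (x ≢_) L → Linked (E G) L → Linked (E (deleteEdge G x y)) L
  linked-avoiding _ [] = []
  linked-avoiding _ [-] = [-]
  linked-avoiding {G = G} {y = y} (x≢p ∷ x≢q ∷ x≢L) (e ∷ linked) =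
    (e , λ pq≈xy → ¬SameEdge x≢p x≢q (SameEdge-sym pq≈xy)) ∷ linked-avoiding {G = G} {y = y} (x≢q ∷ x≢L) linked

  linked⇒walk : ∀ p L y → Linked (E G) (p ∷ L ∷ʳ y) → All (V G) (L ∷ʳ y) → Walk G p y
  linked⇒walk p [] y (e ∷ _) (y∈V ∷ _) = cons e (nil y∈V)
  linked⇒walk p (q ∷ L) y (e ∷ linked) (_ ∷ L∈V) = cons e (linked⇒walk q L y linked L∈V)

  allBridges⇒acyclic : AllBridges G → Acyclic G
  allBridges⇒acyclic bridges (_ , _ , [] , ms≢[] , _) = ms≢[] refl
  allBridges⇒acyclic {G = G} bridges
    (x , y , m ∷ ms , _ , ((x≢mms ∷ m≢msy ∷ _) , xm ∷ linked , x∈V ∷ _ ∷ msy∈V) , yx) =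
    bridges x m xm (linked⇒walk m ms y (linked-avoiding {G = G} {y = m} x≢mms linked) msy∈V
                    ++ʷ cons (yx , ¬SameEdge (≢-sym x≢y) (≢-sym m≢y)) (nil x∈V))
    where
    x≢y : x ≢ y
    x≢y = proj₂ (∷ʳ⁻ {xs = m ∷ ms} x≢mms)
    m≢y : m ≢ y
    m≢y = proj₂ (∷ʳ⁻ {xs = ms} m≢msy)

  walk-addEdge : V G p → V G q → Walk (addEdge G p q) u x →
                 Walk G u x ⊎ (Walk G u p × Walk G q x) ⊎ (Walk G u q × Walk G p x)
  walk-addEdge p∈V q∈V (nil x∈V) = inj₁ (nil x∈V)
  walk-addEdge p∈V q∈V (cons e w) with e | walk-addEdge p∈V q∈V w
  ... | inj₁ e | inj₁ w₀ = inj₁ (cons e w₀)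
  ... | inj₁ e | inj₂ (inj₁ (w₁ , w₂)) = inj₂ (inj₁ (cons e w₁ , w₂))
  ... | inj₁ e | inj₂ (inj₂ (w₁ , w₂)) = inj₂ (inj₂ (cons e w₁ , w₂))
  ... | inj₂ (inj₁ (refl , refl)) | inj₁ w₀ = inj₂ (inj₁ (nil p∈V , w₀))
  ... | inj₂ (inj₁ (refl , refl)) | inj₂ (inj₁ (_ , w₂)) = inj₂ (inj₁ (nil p∈V , w₂))
  ... | inj₂ (inj₁ (refl , refl)) | inj₂ (inj₂ (_ , w₂)) = inj₁ w₂
  ... | inj₂ (inj₂ (refl , refl)) | inj₁ w₀ = inj₂ (inj₂ (nil q∈V , w₀))
  ... | inj₂ (inj₂ (refl , refl)) | inj₂ (inj₁ (_ , w₂)) = inj₁ w₂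
  ... | inj₂ (inj₂ (refl , refl)) | inj₂ (inj₂ (_ , w₂)) = inj₂ (inj₂ (nil q∈V , w₂))

  addEdge-undirected : Undirected G → Undirected (addEdge G p q)
  addEdge-undirected undirected x y (inj₁ e) = inj₁ (undirected x y e)
  addEdge-undirected undirected x y (inj₂ xy≈pq) = inj₂ (SameEdge-swap xy≈pq)

  addEdge-edgesInV : EdgesInV G → V G p → V G q → EdgesInV (addEdge G p q)
  addEdge-edgesInV inV p∈V q∈V x y (inj₁ e) = inV x y e
  addEdge-edgesInV inV p∈V q∈V x y (inj₂ xy≈pq) = SameEdge-ends p∈V q∈V xy≈pq

  deleteEdge-addEdge : E (deleteEdge (addEdge G p q) u v) ⇒ E (addEdge (deleteEdge G u v) p q)
  deleteEdge-addEdge (inj₁ e , xy≉uv) = inj₁ (e , xy≉uv)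
  deleteEdge-addEdge (inj₂ xy≈pq , _) = inj₂ xy≈pq

  addEdge-allBridges : Undirected G → EdgesInV G → V G p → V G q →
                       AllBridges G → ¬ Walk G p q → AllBridges (addEdge G p q)
  addEdge-allBridges {G = G} {p = p} {q = q} undirected inV p∈V q∈V bridges p↮q u v (inj₂ uv≈pq) w =
    p↮q (oriented uv≈pq (mapʷ id old w))
    where
    old : E (deleteEdge (addEdge G p q) u v) ⇒ E G
    old (inj₁ e , _) = e
    old (inj₂ xy≈pq , xy≉uv) = ⊥-elim (xy≉uv (SameEdge-euclidean xy≈pq uv≈pq))
    oriented : SameEdge u v p q → Walk G v u → Walk G p q
    oriented (inj₁ (refl , refl)) v→u = reverseʷ undirected inV v→u
    oriented (inj₂ (refl , refl)) v→u = v→u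
  addEdge-allBridges {G = G} undirected inV p∈V q∈V bridges p↮q u v (inj₁ uv) w
    with walk-addEdge p∈V q∈V (mapʷ id (deleteEdge-addEdge {G = G}) w)
  ... | inj₁ v→u = bridges u v uv v→u
  ... | inj₂ (inj₁ (v→p , q→u)) =
    p↮q (reverse (deleteEdge⊆ v→p) ++ʷ cons (undirected u v uv) (reverse (deleteEdge⊆ q→u)))
    where
    reverse : ∀ {x y} → Walk G x y → Walk G y x
    reverse = reverseʷ undirected inV
  ... | inj₂ (inj₂ (v→q , p→u)) = p↮q (deleteEdge⊆ p→u ++ʷ cons uv (deleteEdge⊆ v→q))

  component-simple : IsSimple G → IsSimple (component G u)
  component-simple (undirected , loopless , _) =
    (λ x y (e , u↝x , u↝y) → undirected x y e , u↝y , u↝x) ,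
    (λ x → loopless x ∘ proj₁) ,
    (λ x y (_ , u↝x , u↝y) → u↝x , u↝y)

  switch-simple : IsSimple G → Interchangeable τ G → IsSimple (switch τ G)
  switch-simple {G = G} {τ = τ} (undirected , loopless , inV) (ab , cd , a≢c , _ , _ , b≢d , _) =
    undirected′ , loopless′ , inV′
    where
    undirected′ : Undirected (switch τ G)
    undirected′ x y (inj₁ (e , ≉ab , ≉cd)) =
      inj₁ (undirected x y e , ≉ab ∘ SameEdge-swap , ≉cd ∘ SameEdge-swap)
    undirected′ x y (inj₂ (inj₁ ≈ac)) = inj₂ (inj₁ (SameEdge-swap ≈ac))
    undirected′ x y (inj₂ (inj₂ ≈bd)) = inj₂ (inj₂ (SameEdge-swap ≈bd))
    loopless′ : Loopless (switch τ G)
    loopless′ x (inj₁ (e , _)) = loopless x e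
    loopless′ x (inj₂ (inj₁ ≈ac)) = a≢c (SameEdge-loop ≈ac)
    loopless′ x (inj₂ (inj₂ ≈bd)) = b≢d (SameEdge-loop ≈bd)
    inV′ : EdgesInV (switch τ G)
    inV′ x y (inj₁ (e , _)) = inV x y e
    inV′ x y (inj₂ (inj₁ ≈ac)) = SameEdge-ends (proj₁ (inV _ _ ab)) (proj₁ (inV _ _ cd)) ≈ac
    inV′ x y (inj₂ (inj₂ ≈bd)) = SameEdge-ends (proj₂ (inV _ _ ab)) (proj₂ (inV _ _ cd)) ≈bd

module Switching {n : ℕ} (F : Graph n) (τ : Switch n)
  (undirectedF : Undirected F) (looplessF : Loopless F) (inVF : EdgesInV F) (acyclicF : Acyclic F)
  (ab∈F : E F (a τ) (b τ)) (cd∈F : E F (c τ) (d τ))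
  (a≢c : a τ ≢ c τ) (a≢d : a τ ≢ d τ) (b≢c : b τ ≢ c τ) (b≢d : b τ ≢ d τ)
  (ac∉F : ¬ E F (a τ) (c τ)) (bd∉F : ¬ E F (b τ) (d τ)) where

  open Switch τ using () renaming (a to A; b to B; c to C; d to D)

  private variable
    x y u v : Fin n

  simpleF : IsSimple F
  simpleF = undirectedF , looplessF , inVF

  interchangeable : Interchangeable τ F
  interchangeable = ab∈F , cd∈F , a≢c , a≢d , b≢c , b≢d , ac∉F , bd∉F

  a∈V : V F A
  a∈V = proj₁ (inVF A B ab∈F)

  b∈V : V F B
  b∈V = proj₂ (inVF A B ab∈F)

  c∈V : V F C
  c∈V = proj₁ (inVF C D cd∈F)

  d∈V : V F D
  d∈V = proj₂ (inVF C D cd∈F)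

  bridgesF : AllBridges F
  bridgesF = acyclic⇒allBridges simpleF acyclicF

  τF : Graph n
  τF = switch τ F

  τF-simple : IsSimple τF
  τF-simple = switch-simple simpleF interchangeable

  core : Graph n
  core = record { V = V F ; E = λ x y → E F x y × ¬ SameEdge x y A B × ¬ SameEdge x y C D }

  core-undirected : Undirected core
  core-undirected x y (e , ≉ab , ≉cd) = undirectedF x y e , ≉ab ∘ SameEdge-swap , ≉cd ∘ SameEdge-swap

  core-edgesInV : EdgesInV core
  core-edgesInV x y (e , _) = inVF x y e

  core⇒F : Walk core x y → Walk F x y
  core⇒F = mapʷ id proj₁

  reverse-core : Walk core x y → Walk core y x
  reverse-core = reverseʷ core-undirected core-edgesInV

  core-bridges : AllBridges core
  core-bridges = AllBridges-anti id proj₁ bridgesF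

  core-b↮a : ¬ Walk core B A
  core-b↮a w = bridgesF A B ab∈F (mapʷ id (λ (e , ≉ab , _) → e , ≉ab) w)

  separated⇒forest : ¬ Walk F A C → IsFSwitch τ F
  separated⇒forest a↮c =
    interchangeable , τF-simple , allBridges⇒acyclic (AllBridges-anti id assocˡ core+ac+bd-bridges)
    where
    core+ac-bridges : AllBridges (addEdge core A C)
    core+ac-bridges =
      addEdge-allBridges core-undirected core-edgesInV a∈V c∈V core-bridges (a↮c ∘ core⇒F)

    b↮d : ¬ Walk (addEdge core A C) B D
    b↮d w with walk-addEdge a∈V c∈V w
    ... | inj₁ b→d = a↮c (cons ab∈F (core⇒F b→d ++ʷ cons (undirectedF C D cd∈F) (nil c∈V)))
    ... | inj₂ (inj₁ (b→a , _)) = core-b↮a b→a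
    ... | inj₂ (inj₂ (b→c , _)) = a↮c (cons ab∈F (core⇒F b→c))

    core+ac+bd-bridges : AllBridges (addEdge (addEdge core A C) B D)
    core+ac+bd-bridges =
      addEdge-allBridges (addEdge-undirected {G = core} {p = A} {q = C} core-undirected) (addEdge-edgesInV core-edgesInV a∈V c∈V)
                         b∈V d∈V core+ac-bridges b↮d

  module SameComponent (a↝c : Walk F A C) where

    T : Graph n
    T = component F A

    τT : Graph n
    τT = switch τ T

    extend : Walk F A x → E F x y → Walk F A y
    extend a↝x e = a↝x ++ʷ cons e (nil (proj₂ (inVF _ _ e)))

    a∈T : Walk F A A
    a∈T = nil a∈V

    b∈T : Walk F A B
    b∈T = cons ab∈F (nil b∈V)

    d∈T : Walk F A D
    d∈T = extend a↝c cd∈F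

    new-edge-in-T : SameEdge x y A C ⊎ SameEdge x y B D → Walk F A x × Walk F A y
    new-edge-in-T (inj₁ ≈ac) = SameEdge-ends a∈T a↝c ≈ac
    new-edge-in-T (inj₂ ≈bd) = SameEdge-ends b∈T d∈T ≈bd

    τF⇒τT : Walk F A x → E τF x y → Walk F A y × E τT x y
    τF⇒τT a↝x (inj₁ (e , ≉ab , ≉cd)) = extend a↝x e , inj₁ ((e , a↝x , extend a↝x e) , ≉ab , ≉cd)
    τF⇒τT _ (inj₂ new) = proj₂ (new-edge-in-T new) , inj₂ new

    τT⇒τF : E τT ⇒ E τF
    τT⇒τF (inj₁ ((e , _) , ≉ab , ≉cd)) = inj₁ (e , ≉ab , ≉cd)
    τT⇒τF (inj₂ new) = inj₂ new

    interchangeableT : Interchangeable τ T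
    interchangeableT =
      (ab∈F , a∈T , b∈T) , (cd∈F , a↝c , d∈T) , a≢c , a≢d , b≢c , b≢d , ac∉F ∘ proj₁ , bd∉F ∘ proj₁

    τT-simple : IsSimple τT
    τT-simple = switch-simple (component-simple simpleF) interchangeableT

    reverse-τT : Walk τT x y → Walk τT y x
    reverse-τT = reverseʷ (proj₁ τT-simple) (proj₂ (proj₂ τT-simple))

    core⇒τT : Walk F A x → Walk core x y → Walk τT x y
    core⇒τT = mapʷ-from (Walk F A) id (λ a↝x e → τF⇒τT a↝x (inj₁ e))

    F⇒core+ab+cd : E F ⇒ E (addEdge (addEdge core A B) C D)
    F⇒core+ab+cd {x} {y} e with SameEdge? x y C D | SameEdge? x y A B
    ... | yes ≈cd | _ = inj₂ ≈cd
    ... | no _ | yes ≈ab = inj₁ (inj₂ ≈ab)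
    ... | no ≉cd | no ≉ab = inj₁ (inj₁ (e , ≉ab , ≉cd))

    module _ (τF-bridges : AllBridges τF) where

      core-c↮a : ¬ Walk core C A
      core-c↮a w = τF-bridges A C (inj₂ (inj₁ (inj₁ (refl , refl))))
        (mapʷ id (λ (e , ≉ab , ≉cd) → inj₁ (e , ≉ab , ≉cd) , nonEdge-≉ {G = F} undirectedF e ac∉F) w)

      core-d↮b : ¬ Walk core D B
      core-d↮b w = τF-bridges B D (inj₂ (inj₂ (inj₁ (refl , refl))))
        (mapʷ id (λ (e , ≉ab , ≉cd) → inj₁ (e , ≉ab , ≉cd) , nonEdge-≉ {G = F} undirectedF e bd∉F) w)

      a⇝b-via-c : Walk (addEdge core A B) A C → Walk τT A B
      a⇝b-via-c w with walk-addEdge a∈V b∈V w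
      ... | inj₁ a→c = ⊥-elim (core-c↮a (reverse-core a→c))
      ... | inj₂ (inj₁ (_ , b→c)) =
        reverse-τT (core⇒τT b∈T b→c ++ʷ cons (inj₂ (inj₁ (inj₂ (refl , refl)))) (nil a∈T))
      ... | inj₂ (inj₂ (a→b , _)) = ⊥-elim (core-b↮a (reverse-core a→b))

      a⇝b-via-d : Walk (addEdge core A B) A D → Walk τT A B
      a⇝b-via-d w with walk-addEdge a∈V b∈V w
      ... | inj₁ a→d = core⇒τT a∈T a→d ++ʷ cons (inj₂ (inj₂ (inj₂ (refl , refl)))) (nil b∈T)
      ... | inj₂ (inj₁ (_ , b→d)) = ⊥-elim (core-d↮b (reverse-core b→d))
      ... | inj₂ (inj₂ (a→b , _)) = ⊥-elim (core-b↮a (reverse-core a→b))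

      a⇝b : Walk τT A B
      a⇝b with walk-addEdge c∈V d∈V (mapʷ id F⇒core+ab+cd a↝c)
      ... | inj₁ a→c = a⇝b-via-c a→c
      ... | inj₂ (inj₁ (a→c , _)) = a⇝b-via-c a→c
      ... | inj₂ (inj₂ (a→d , _)) = a⇝b-via-d a→d

      a⇝c : Walk τT A C
      a⇝c = cons (inj₂ (inj₁ (inj₁ (refl , refl)))) (nil a↝c)

      a⇝d : Walk τT A D
      a⇝d = a⇝b ++ʷ cons (inj₂ (inj₂ (inj₁ (refl , refl)))) (nil d∈T)

      reach-τT : Walk F A x → Walk τT A x
      reach-τT = proj₁ ∘ invariant-along (λ x → Walk τT A x × Walk F A x) step (nil a∈T , a∈T)
        where
        step : Walk τT A x × Walk F A x → E F x y → Walk τT A y × Walk F A y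
        step {x} {y} (a⇝x , a↝x) e with SameEdge? x y A B | SameEdge? x y C D
        ... | yes ≈ab | _ = proj₂ (SameEdge-ends (nil a∈T , a∈T) (a⇝b , b∈T) ≈ab)
        ... | no _ | yes ≈cd = proj₂ (SameEdge-ends (a⇝c , a↝c) (a⇝d , d∈T) ≈cd)
        ... | no ≉ab | no ≉cd =
          let a↝y , xy = τF⇒τT a↝x (inj₁ (e , ≉ab , ≉cd)) in a⇝x ++ʷ cons xy (nil a↝y) , a↝y

      τT-connected : Connected τT
      τT-connected x y a↝x a↝y = reverse-τT (reach-τT a↝x) ++ʷ reach-τT a↝y

    forest⇒tree : IsFSwitch τ F → IsTSwitch τ T
    forest⇒tree (_ , _ , τF-acyclic) =
      interchangeableT ,
      (τT-simple , allBridges⇒acyclic (AllBridges-anti end∈V τT⇒τF τF-bridges)) ,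
      τT-connected τF-bridges
      where
      τF-bridges : AllBridges τF
      τF-bridges = acyclic⇒allBridges τF-simple τF-acyclic

    walk-in-F⊎from-T : Walk (deleteEdge τF u v) x y → Walk (deleteEdge F u v) x y ⊎ Walk F A x
    walk-in-F⊎from-T (nil x∈V) = inj₁ (nil x∈V)
    walk-in-F⊎from-T (cons (inj₁ (e , _) , ≉uv) w) with walk-in-F⊎from-T w
    ... | inj₁ w′ = inj₁ (cons (e , ≉uv) w′)
    ... | inj₂ a↝y = inj₂ (extend a↝y (undirectedF _ _ e))
    walk-in-F⊎from-T (cons (inj₂ new , _) _) = inj₂ (proj₁ (new-edge-in-T new))

    closing-vertex-in-T : E τF u v → Walk (deleteEdge τF u v) v u → Walk F A v
    closing-vertex-in-T uv w with walk-in-F⊎from-T w | uv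
    ... | inj₂ a↝v | _ = a↝v
    ... | inj₁ v→u | inj₁ (e , _) = ⊥-elim (bridgesF _ _ e v→u)
    ... | inj₁ _ | inj₂ new = proj₂ (new-edge-in-T new)

    tree⇒forest : IsTSwitch τ T → IsFSwitch τ F
    tree⇒forest (_ , (_ , τT-acyclic) , _) =
      interchangeable , τF-simple , allBridges⇒acyclic τF-bridges
      where
      τT-bridges : AllBridges τT
      τT-bridges = acyclic⇒allBridges τT-simple τT-acyclic

      τF-bridges : AllBridges τF
      τF-bridges u v uv w =
        let a↝v = closing-vertex-in-T uv w
            a↝u = proj₁ (τF⇒τT a↝v (proj₁ τF-simple u v uv))
        in τT-bridges u v (proj₂ (τF⇒τT a↝u uv))
             (mapʷ-from (Walk F A) id (λ a↝x (e , ≉uv) → map₂ (_, ≉uv) (τF⇒τT a↝x e)) a↝v w)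

theorem5 : ∀ {n} (F : Graph n) (τ : Switch n) →
    Decidable (V F) → Decidable₂ (E F) →
    IsForest F → Interchangeable τ F →
    (Reachable F (a τ) (c τ) → (IsFSwitch τ F ⇔ IsTSwitch τ (component F (a τ))))
    × (¬ Reachable F (a τ) (c τ) → IsFSwitch τ F)
-- The decidability hypotheses are unnecessary: equality on Fin n is decidable.
theorem5 F τ _ _ ((undirected , loopless , inV) , acyclic) (ab , cd , a≢c , a≢d , b≢c , b≢d , ac∉ , bd∉) =
  (λ a↝c → mk⇔ (forest⇒tree a↝c) (tree⇒forest a↝c)) , separated⇒forest
  where
  open Switching F τ undirected loopless inV acyclic ab cd a≢c a≢d b≢c b≢d ac∉ bd∉
  open SameComponent
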